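{- In the call-by-value $\lambda$-calculus, the function $\mathrm{lam}$ strongly evolves to $\mathrm{lam}\cup\mathrm{red},\ \mathrm{lam}\cup\mathrm{red}$; that is, for all relations $R,S,T$ on terms with $R\rightsquigarrow S,T$, we have $\mathrm{lam}(R)\rightsquigarrow (\mathrm{lam}\cup\mathrm{red})(S),\ (\mathrm{lam}\cup\mathrm{red})(T)$.
   Context: Call-by-value $\lambda$-calculus: terms $t,s ::= v \mid t\,s$, values $v,w ::= x \mid \lambda x.t$ (terms modulo $\alpha$-conversion; $t\{v/x\}$ is capture-avoiding substitution), evaluation contexts $E ::= [\,] \mid E\,t \mid v\,E$. Reduction: $E[(\lambda x.t)\,v]\to E[t\{v/x\}]$; $\to^*$ is its reflexive-transitive closure; $t\Downarrow s$ means $t\to^* s$ and $s$ is irreducible. A variable is fresh if it does not occur in the terms/contexts under consideration. For a relation $R$ on terms: $v \mathrel{R^{v}} w$ iff $(v\,x)\mathrel R (w\,x)$ for a fresh $x$; $E\mathrel{R^{E}}E'$ iff $E[x]\mathrel R E'[x]$ for a fresh $x$; $E[x\,v]\mathrel{R^{o}}E'[x\,w]$ iff $E\mathrel{R^E}E'$ and $v\mathrel{R^v}w$. Diacritical progress: $R\rightsquigarrow S,T$ iff $R\subseteq S\subseteq T$ and whenever $t\mathrel R s$: (i) if $t\to t'$ then there is $s'$ with $s\to^*s'$ and $t'\mathrel T s'$; (ii) if $t$ is a value $v$ then $s\Downarrow w$ for some value $w$ with $v\mathrel{S^v}w$; (iii) if $t=E[x\,v]$ then $s\Downarrow E'[x\,w]$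 for some $E',w$ with $E[x\,v]\mathrel{T^o}E'[x\,w]$; (iv) the symmetric conditions with the roles of $t$ and $s$ exchanged. Functions on relations: $(f\cup g)(R)=f(R)\cup g(R)$; $\mathrm{lam}(R)=\{(\lambda x.t,\lambda x.s)\mid t\mathrel R s\}$; $\mathrm{red}(R)=\{(t,s)\mid t\to^*t',\ s\to^*s',\ t'\mathrel R s'\}$. -}

module Defs where

open import Data.Nat using (ℕ; zero; suc)
open import Data.Product using (Σ; ∃; ∃-syntax; _×_; _,_)
open import Data.Sum using (_⊎_)
open import Relation.Nullary using (¬_)
open import Relation.Binary.PropositionalEquality using (_≡_)
open import Relation.Binary.Construct.Closure.ReflexiveTransitive using (Star)

-- Call-by-value λ-calculus, terms modulo α-conversion represented with
-- de Bruijn indices (untyped/unscoped: free variables are natural numbers).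
--   terms  t ::= v | t s        values v ::= x | λ.t
mutual
  data Val : Set where
    var : ℕ → Val
    lam : Term → Val

  data Term : Set where
    val : Val → Term
    app : Term → Term → Term

ext : (ℕ → ℕ) → ℕ → ℕ
ext ρ zero    = zero
ext ρ (suc n) = suc (ρ n)

mutual
  renV : (ℕ → ℕ) → Val → Val
  renV ρ (var x) = var (ρ x)
  renV ρ (lam t) = lam (renT (ext ρ) t)

  renT : (ℕ → ℕ) → Term → Term
  renT ρ (val v)   = val (renV ρ v)
  renT ρ (app t s) = app (renT ρ t) (renT ρ s)

exts : (ℕ → Val) → ℕ → Val
exts σ zero    = var zero
exts σ (suc n) = renV suc (σ n)

mutual
  subV : (ℕ → Val) → Val → Val
  subV σ (var x) = σ x
  subV σ (lam t) = lam (subT (exts σ) t)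

  subT : (ℕ → Val) → Term → Term
  subT σ (val v)   = val (subV σ v)
  subT σ (app t s) = app (subT σ t) (subT σ s)

-- t{v/x} where x is the bound variable (index 0)
single : Val → ℕ → Val
single v zero    = v
single v (suc n) = var n

_[_] : Term → Val → Term
t [ v ] = subT (single v) t

data ECtx : Set where
  hole : ECtx
  appL : ECtx → Term → ECtx
  appR : Val → ECtx → ECtx

plug : ECtx → Term → Term
plug hole       u = u
plug (appL E t) u = app (plug E u) t
plug (appR v E) u = app (val v) (plug E u)

renE : (ℕ → ℕ) → ECtx → ECtx
renE ρ hole       = hole
renE ρ (appL E t) = appL (renE ρ E) (renT ρ t)
renE ρ (appR v E) = appR (renV ρ v) (renE ρ E)

data _⟶_ : Term → Term → Set where
  β : ∀ E t v → plug E (app (val (lam t)) (val v)) ⟶ plug E (t [ v ])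

_⟶*_ : Term → Term → Set
_⟶*_ = Star _⟶_

Irreducible : Term → Set
Irreducible t = ¬ (∃[ t' ] (t ⟶ t'))

_⇓_ : Term → Term → Set
t ⇓ s = (t ⟶* s) × Irreducible s

TRel : Set₁
TRel = Term → Term → Set

_⊆_ : TRel → TRel → Set
R ⊆ S = ∀ {t s} → R t s → S t s

flipR : TRel → TRel
flipR R t s = R s t

-- "fresh variable x": shift all free variables up by one and use index 0.
_ᵛ : TRel → Val → Val → Set
(R ᵛ) v w = R (app (val (renV suc v)) (val (var zero)))
              (app (val (renV suc w)) (val (var zero)))

_ᴱ : TRel → ECtx → ECtx → Set
(R ᴱ) E E' = R (plug (renE suc E) (val (var zero)))
               (plug (renE suc E') (val (var zero)))

_ᵒ : TRel → TRel
(R ᵒ) t s = ∃[ E ] ∃[ x ] ∃[ v ] ∃[ E' ] ∃[ w ]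
  ( (t ≡ plug E  (app (val (var x)) (val v)))
  × (s ≡ plug E' (app (val (var x)) (val w)))
  × (R ᴱ) E E' × (R ᵛ) v w )

-- Conditions (i)-(iii) for a pair t R s
Half : TRel → TRel → Term → Term → Set
Half S T t s =
    (∀ t' → t ⟶ t' → ∃[ s' ] ((s ⟶* s') × T t' s'))
  × (∀ v → t ≡ val v → ∃[ w ] ((s ⇓ val w) × (S ᵛ) v w))
  × (∀ E x v → t ≡ plug E (app (val (var x)) (val v)) →
       ∃[ E' ] ∃[ w ] ((s ⇓ plug E' (app (val (var x)) (val w)))
                      × (T ᵒ) t (plug E' (app (val (var x)) (val w)))))

_⇝_,_ : TRel → TRel → TRel → Set
R ⇝ S , T = (R ⊆ S) × (S ⊆ T)
  × (∀ t s → R t s → Half S T t s × Half (flipR S) (flipR T) s t)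

_∪R_ : TRel → TRel → TRel
(R ∪R S) t s = R t s ⊎ S t s

_∪F_ : (TRel → TRel) → (TRel → TRel) → TRel → TRel
(f ∪F g) R = f R ∪R g R

data Lam (R : TRel) : TRel where
  lamR : ∀ {t s} → R t s → Lam R (val (lam t)) (val (lam s))

data Red (R : TRel) : TRel where
  redR : ∀ {t s t' s'} → t ⟶* t' → s ⟶* s' → R t' s' → Red R t s

module Submission where

open import Defs
open import Data.Nat using (zero; suc)
open import Data.Product using (_,_)
open import Data.Sum using (inj₁; inj₂)
open import Data.Empty using (⊥-elim)
open import Relation.Nullary using (¬_)
open import Relation.Binary.PropositionalEquality using (_≡_; refl; sym; cong; cong₂; subst)
open import Relation.Binary.Construct.Closure.ReflexiveTransitive using (ε; _◅_)

-- Abstractions are values, so clauses (i) and (iii) of progress are vacuous for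
-- them, and clause (ii) asks for λx.t and λx.s applied to a fresh variable to be
-- related; these applications β-reduce in one step to t and s, hence red(S)
-- relates them.

plug-app≢val : ∀ E u w v → ¬ plug E (app u w) ≡ val v
plug-app≢val hole       u w v ()
plug-app≢val (appL E t) u w v ()
plug-app≢val (appR x E) u w v ()

⟶-source≢val : ∀ {t t'} v → t ⟶ t' → ¬ t ≡ val v
⟶-source≢val v (β E t w) = plug-app≢val E _ _ v

val-irreducible : ∀ v → Irreducible (val v)
val-irreducible v (_ , t⟶t') = ⟶-source≢val v t⟶t' refl

val-Half : ∀ S {T} v w → (S ᵛ) v w → Half S T (val v) (val w)
val-Half S v w vSᵛw =
    (λ t' v⟶t' → ⊥-elim (⟶-source≢val v v⟶t' refl))
  , (λ { _ refl → w , (ε , val-irreducible w) , vSᵛw })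
  , (λ E x u eq → ⊥-elim (plug-app≢val E _ _ v (sym eq)))

mutual
  subV-renV-inverse : ∀ ρ σ → (∀ x → σ (ρ x) ≡ var x) → ∀ v → subV σ (renV ρ v) ≡ v
  subV-renV-inverse ρ σ σ∘ρ≗var (var x) = σ∘ρ≗var x
  subV-renV-inverse ρ σ σ∘ρ≗var (lam t) =
    cong lam (subT-renT-inverse (ext ρ) (exts σ) exts∘ext≗var t)
    where
    exts∘ext≗var : ∀ x → exts σ (ext ρ x) ≡ var x
    exts∘ext≗var zero    = refl
    exts∘ext≗var (suc x) = cong (renV suc) (σ∘ρ≗var x)

  subT-renT-inverse : ∀ ρ σ → (∀ x → σ (ρ x) ≡ var x) → ∀ t → subT σ (renT ρ t) ≡ t
  subT-renT-inverse ρ σ σ∘ρ≗var (val v)   = cong val (subV-renV-inverse ρ σ σ∘ρ≗var v)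
  subT-renT-inverse ρ σ σ∘ρ≗var (app t s) =
    cong₂ app (subT-renT-inverse ρ σ σ∘ρ≗var t) (subT-renT-inverse ρ σ σ∘ρ≗var s)

lam-app-fresh⟶* : ∀ t → app (val (renV suc (lam t))) (val (var zero)) ⟶* t
lam-app-fresh⟶* t =
  subst (app (val (renV suc (lam t))) (val (var zero)) ⟶*_)
        (subT-renT-inverse (ext suc) (single (var zero)) single-fresh∘ext≗var t)
        (β hole (renT (ext suc) t) (var zero) ◅ ε)
  where
  single-fresh∘ext≗var : ∀ x → single (var zero) (ext suc x) ≡ var x
  single-fresh∘ext≗var zero    = refl
  single-fresh∘ext≗var (suc x) = refl

Red-ᵛ-lam : ∀ {S t s} → S t s → (Red S ᵛ) (lam t) (lam s)
Red-ᵛ-lam {t = t} {s} tSs = redR (lam-app-fresh⟶* t) (lam-app-fresh⟶* s) tSs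

Lam∪Red-mono : ∀ {S T} → S ⊆ T → (Lam ∪F Red) S ⊆ (Lam ∪F Red) T
Lam∪Red-mono S⊆T (inj₁ (lamR tSs))       = inj₁ (lamR (S⊆T tSs))
Lam∪Red-mono S⊆T (inj₂ (redR t⟶* s⟶* r)) = inj₂ (redR t⟶* s⟶* (S⊆T r))

lemma3p18 : (R S T : TRel) → R ⇝ S , T →
              Lam R ⇝ (Lam ∪F Red) S , (Lam ∪F Red) T
lemma3p18 R S T (R⊆S , S⊆T , _) =
    (λ { (lamR tRs) → inj₁ (lamR (R⊆S tRs)) })
  , Lam∪Red-mono S⊆T
  , λ { _ _ (lamR {t} {s} tRs) →
          let related = inj₂ (Red-ᵛ-lam (R⊆S tRs)) in
          val-Half ((Lam ∪F Red) S) (lam t) (lam s) related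
        , val-Half (flipR ((Lam ∪F Red) S)) (lam s) (lam t) related }
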